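{- Let $r\ge0$ be an integer and consider the problem $\mathrm{MAX}(r)$: maximise $\mathrm{OBJ}(\vec m)=\prod_{i=1}^s m_i$ over all integers $0\le s\le r$ and vectors $\vec m=(m_1,\dots,m_s)$ of positive integers with $\sum_{i=1}^s m_i=r$; let $\mathrm{OPT}(r)$ be its optimal value. Then: (i) for every feasible $\vec m$, either $\mathrm{OBJ}(\vec m)=\mathrm{OPT}(r)$ or $\mathrm{OBJ}(\vec m)\le\frac89\mathrm{OPT}(r)$; (ii) for $r\ge2$, every optimal solution has one of the following forms (up to the order of coordinates): if $r\equiv0\pmod 3$, $s=r/3$ and all coordinates equal $3$; if $r\equiv1\pmod3$, either $s=\lfloor r/3\rfloor$ with one coordinate equal to $4$ and all others equal to $3$, or $s=\lceil r/3\rceil$ with two coordinates equal to $2$ and all others equal to $3$; if $r\equiv2\pmod3$, $s=\lceil r/3\rceil$ with one coordinate equal to $2$ and all others equal to $3$. -}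

module Defs where

open import Data.Nat using (ℕ; _<_; _≤_; _*_; _+_)
open import Data.List using (List; length)
open import Data.Nat.ListAction using (sum; product)
open import Data.List.Relation.Unary.All using (All)
open import Data.Product using (_×_; Σ)
open import Relation.Binary.PropositionalEquality using (_≡_)

Feasible : ℕ → List ℕ → Set
Feasible r m = All (0 <_) m × length m ≤ r × sum m ≡ r

OBJ : List ℕ → ℕ
OBJ = product

IsOPT : ℕ → ℕ → Set
IsOPT r v = Σ (List ℕ) (λ m → Feasible r m × OBJ m ≡ v)
          × (∀ m → Feasible r m → OBJ m ≤ v)

module Submission where

-- Write opt for OPT. Then opt (3 + r) = 3 · opt r for r ≥ 2, and the optimal
-- lists are, up to order, the canonical ones: [], [1], or threes followed by
-- one of [2], [3], [4], [2,2]. Build a feasible list part by part. Adding a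
-- part a to a canonical list of sum b yields, up to order, a canonical list of
-- sum a + b, or a product at most 8/9 · opt (a + b). Parts a ≥ 5 always lose
-- the factor 8/9; for a ≤ 4 the leading threes of the list cancel against the
-- factor 3 in opt, leaving finitely many cases. Since a · opt b ≤ opt (a + b),
-- a lost factor 8/9 is never recovered, so a feasible list is either a
-- permutation of a canonical one, whose shapes are those of (ii), or has
-- OBJ ≤ 8/9 · OPT.

open import Defs
open import Algebra.Properties.CommutativeSemigroup using (x∙yz≈y∙xz)
open import Data.Empty using (⊥-elim)
open import Data.List using (List; []; _∷_; _++_; replicate; length)
open import Data.List.Relation.Binary.Permutation.Propositional using (_↭_; ↭-refl; ↭-sym; ↭-trans; prep; swap)
open import Data.List.Relation.Binary.Permutation.Propositional.Properties using (shift)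
open import Data.List.Relation.Unary.All using (All; []; _∷_)
open import Data.Nat using (ℕ; suc; _+_; _*_; _∸_; _/_; _%_; _≤_; _<_; z≤n; s≤s; _≤?_)
open import Data.Nat.DivMod using (m/n≡1+[m∸n]/n; m≥n⇒m/n>0)
open import Data.Nat.ListAction using (sum; product)
open import Data.Nat.ListAction.Properties using (product-↭)
open import Data.Nat.Properties
open import Data.Product using (_×_; ∃; ∃-syntax; _,_)
open import Data.Sum using (_⊎_; inj₁; inj₂; [_,_]′)
import Data.Sum as Sum
open import Function using (_∘′_)
open import Relation.Binary.PropositionalEquality using (_≡_; refl; sym; trans; cong; subst; module ≡-Reasoning)
open import Relation.Nullary.Decidable using (True; toWitness)

variable
  a b r q ρ : ℕ
  c m : List ℕ

≤-by-computation : {p : True (a ≤? b)} → a ≤ b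
≤-by-computation {p = p} = toWitness p

*-left-comm : ∀ x y z → x * (y * z) ≡ y * (x * z)
*-left-comm = x∙yz≈y∙xz *-commutativeSemigroup

+-left-comm : ∀ x y z → x + (y + z) ≡ y + (x + z)
+-left-comm = x∙yz≈y∙xz +-commutativeSemigroup

*-scale-≤ : ∀ s k l u v → k * u ≤ l * v → k * (s * u) ≤ l * (s * v)
*-scale-≤ s k l u v ku≤lv = begin
  k * (s * u) ≡⟨ *-left-comm k s u ⟩
  s * (k * u) ≤⟨ *-monoʳ-≤ s ku≤lv ⟩
  s * (l * v) ≡⟨ *-left-comm s l v ⟩
  l * (s * v) ∎
  where open ≤-Reasoning

9*m≤8*n⇒m≤n : ∀ m n → 9 * m ≤ 8 * n → m ≤ n
9*m≤8*n⇒m≤n m n 9m≤8n = *-cancelˡ-≤ 9 (≤-trans 9m≤8n (*-monoˡ-≤ n (≤-by-computation {8} {9})))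

length≤sum : All (0 <_) m → length m ≤ sum m
length≤sum [] = z≤n
length≤sum (x>0 ∷ xs>0) = +-mono-≤ x>0 (length≤sum xs>0)

3∷-↭ : ∀ xs → c ↭ xs ++ replicate q 3 → 3 ∷ c ↭ xs ++ replicate (suc q) 3
3∷-↭ xs c↭ = ↭-trans (prep 3 c↭) (↭-sym (shift 3 xs _))

3∷-↭-pred : ∀ xs → 1 ≤ q → c ↭ xs ++ replicate (q ∸ 1) 3 → 3 ∷ c ↭ xs ++ replicate q 3
3∷-↭-pred {q = suc _} xs _ = 3∷-↭ xs

induction-by-threes : (P : ℕ → Set) → P 0 → P 1 → P 2 → P 3 → P 4 →
                      (∀ n → P (2 + n) → P (5 + n)) → ∀ n → P n
induction-by-threes P p₀ p₁ p₂ p₃ p₄ step 0 = p₀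
induction-by-threes P p₀ p₁ p₂ p₃ p₄ step 1 = p₁
induction-by-threes P p₀ p₁ p₂ p₃ p₄ step 2 = p₂
induction-by-threes P p₀ p₁ p₂ p₃ p₄ step 3 = p₃
induction-by-threes P p₀ p₁ p₂ p₃ p₄ step 4 = p₄
induction-by-threes P p₀ p₁ p₂ p₃ p₄ step (suc (suc (suc (suc (suc n))))) =
  step n (induction-by-threes P p₀ p₁ p₂ p₃ p₄ step (suc (suc n)))

opt : ℕ → ℕ
opt 0 = 1
opt 1 = 1
opt 2 = 2
opt 3 = 3
opt 4 = 4
opt (suc (suc (suc (suc (suc n))))) = 3 * opt (suc (suc n))

opt-3+ : 2 ≤ r → opt (3 + r) ≡ 3 * opt r
opt-3+ (s≤s (s≤s z≤n)) = refl

opt-positive : ∀ r → 0 < opt r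
opt-positive = induction-by-threes (λ r → 0 < opt r)
  ≤-by-computation ≤-by-computation ≤-by-computation ≤-by-computation ≤-by-computation
  (λ _ → *-monoʳ-< 3)

data Canonical : ℕ → List ℕ → Set where
  [] : Canonical 0 []
  [1] : Canonical 1 (1 ∷ [])
  [2] : Canonical 2 (2 ∷ [])
  [3] : Canonical 3 (3 ∷ [])
  [4] : Canonical 4 (4 ∷ [])
  [2,2] : Canonical 4 (2 ∷ 2 ∷ [])
  3∷ : 2 ≤ r → Canonical r c → Canonical (3 + r) (3 ∷ c)

Canonical↭ : ℕ → List ℕ → Set
Canonical↭ r m = ∃[ c ] Canonical r c × m ↭ c

canonical : ∀ r → ∃ (Canonical r)
canonical = induction-by-threes (λ r → ∃ (Canonical r))
  (_ , []) (_ , [1]) (_ , [2]) (_ , [3]) (_ , [4])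
  (λ _ (c , cc) → 3 ∷ c , 3∷ (s≤s (s≤s z≤n)) cc)

canonical-product : Canonical r c → product c ≡ opt r
canonical-product [] = refl
canonical-product [1] = refl
canonical-product [2] = refl
canonical-product [3] = refl
canonical-product [4] = refl
canonical-product [2,2] = refl
canonical-product (3∷ r≥2 cc) = trans (cong (3 *_) (canonical-product cc)) (sym (opt-3+ r≥2))

canonical↭-product : Canonical↭ r m → product m ≡ opt r
canonical↭-product (_ , cc , m↭c) = trans (product-↭ m↭c) (canonical-product cc)

canonical-sum : Canonical r c → sum c ≡ r
canonical-sum [] = refl
canonical-sum [1] = refl
canonical-sum [2] = refl
canonical-sum [3] = refl
canonical-sum [4] = refl
canonical-sum [2,2] = refl
canonical-sum (3∷ _ cc) = cong (3 +_) (canonical-sum cc)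

canonical-positive : Canonical r c → All (0 <_) c
canonical-positive [] = []
canonical-positive [1] = ≤-by-computation ∷ []
canonical-positive [2] = ≤-by-computation ∷ []
canonical-positive [3] = ≤-by-computation ∷ []
canonical-positive [4] = ≤-by-computation ∷ []
canonical-positive [2,2] = ≤-by-computation ∷ ≤-by-computation ∷ []
canonical-positive (3∷ _ cc) = ≤-by-computation ∷ canonical-positive cc

canonical-feasible : Canonical r c → Feasible r c
canonical-feasible cc = canonical-positive cc
                      , subst (_ ≤_) (canonical-sum cc) (length≤sum (canonical-positive cc))
                      , canonical-sum cc

ShapeOf : ℕ → ℕ → List ℕ → Set
ShapeOf q ρ m = (ρ ≡ 0 → m ↭ replicate q 3)
              × (ρ ≡ 1 → m ↭ 4 ∷ replicate (q ∸ 1) 3 ⊎ m ↭ 2 ∷ 2 ∷ replicate (q ∸ 1) 3)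
              × (ρ ≡ 2 → m ↭ 2 ∷ replicate q 3)

Shape : ℕ → List ℕ → Set
Shape r = ShapeOf (r / 3) (r % 3)

ShapeOf-↭ : m ↭ c → ShapeOf q ρ c → ShapeOf q ρ m
ShapeOf-↭ m↭c (s₀ , s₁ , s₂) =
  ↭-trans m↭c ∘′ s₀ , Sum.map (↭-trans m↭c) (↭-trans m↭c) ∘′ s₁ , ↭-trans m↭c ∘′ s₂

ShapeOf-3∷ : (ρ ≡ 1 → 1 ≤ q) → ShapeOf q ρ c → ShapeOf (suc q) ρ (3 ∷ c)
ShapeOf-3∷ q≥1 (s₀ , s₁ , s₂) =
    (λ ρ≡0 → 3∷-↭ [] (s₀ ρ≡0))
  , (λ ρ≡1 → Sum.map (3∷-↭-pred (4 ∷ []) (q≥1 ρ≡1)) (3∷-↭-pred (2 ∷ 2 ∷ []) (q≥1 ρ≡1)) (s₁ ρ≡1))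
  , (λ ρ≡2 → 3∷-↭ (2 ∷ []) (s₂ ρ≡2))

[3+r]/3≡1+r/3 : ∀ r → (3 + r) / 3 ≡ suc (r / 3)
[3+r]/3≡1+r/3 r = m/n≡1+[m∸n]/n {3 + r} (s≤s (s≤s (s≤s z≤n)))

-- Remainder 1 with r ≥ 2 forces r ≥ 4, so that r / 3 ∸ 1 in Shape is a true predecessor.
r%3≡1⇒1≤r/3 : 2 ≤ r → r % 3 ≡ 1 → 1 ≤ r / 3
r%3≡1⇒1≤r/3 {1} (s≤s ()) _
r%3≡1⇒1≤r/3 {2} _ ()
r%3≡1⇒1≤r/3 {suc (suc (suc r))} _ _ = m≥n⇒m/n>0 {3 + r} (s≤s (s≤s (s≤s z≤n)))

canonical-shape : 2 ≤ r → Canonical r c → Shape r c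
canonical-shape (s≤s ()) [1]
canonical-shape _ [2] = (λ ()) , (λ ()) , λ _ → ↭-refl
canonical-shape _ [3] = (λ _ → ↭-refl) , (λ ()) , (λ ())
canonical-shape _ [4] = (λ ()) , (λ _ → inj₁ ↭-refl) , (λ ())
canonical-shape _ [2,2] = (λ ()) , (λ _ → inj₂ ↭-refl) , (λ ())
canonical-shape _ (3∷ {r} {c} r≥2 cc) =
  subst (λ q → ShapeOf q (r % 3) (3 ∷ c)) (sym ([3+r]/3≡1+r/3 r))
        (ShapeOf-3∷ (r%3≡1⇒1≤r/3 r≥2) (canonical-shape r≥2 cc))

large-part-gap : ∀ x b → 9 * (5 + x) * opt b ≤ 8 * opt (5 + x + b)
large-part-gap 0 = induction-by-threes (λ b → 9 * 5 * opt b ≤ 8 * opt (5 + b))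
  ≤-by-computation ≤-by-computation ≤-by-computation ≤-by-computation ≤-by-computation
  (λ n → *-scale-≤ 3 (9 * 5) 8 (opt (2 + n)) (opt (7 + n)))
large-part-gap 1 = induction-by-threes (λ b → 9 * 6 * opt b ≤ 8 * opt (6 + b))
  ≤-by-computation ≤-by-computation ≤-by-computation ≤-by-computation ≤-by-computation
  (λ n → *-scale-≤ 3 (9 * 6) 8 (opt (2 + n)) (opt (8 + n)))
large-part-gap 2 = induction-by-threes (λ b → 9 * 7 * opt b ≤ 8 * opt (7 + b))
  ≤-by-computation ≤-by-computation ≤-by-computation ≤-by-computation ≤-by-computation
  (λ n → *-scale-≤ 3 (9 * 7) 8 (opt (2 + n)) (opt (9 + n)))
large-part-gap (suc (suc (suc x))) b = begin
  9 * (8 + x) * opt b       ≤⟨ *-monoˡ-≤ (opt b) (*-monoʳ-≤ 9 8+x≤3*[5+x]) ⟩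
  9 * (3 * (5 + x)) * opt b ≡⟨ cong (_* opt b) (*-left-comm 9 3 (5 + x)) ⟩
  3 * (9 * (5 + x)) * opt b ≡⟨ *-assoc 3 (9 * (5 + x)) (opt b) ⟩
  3 * (9 * (5 + x) * opt b) ≤⟨ *-monoʳ-≤ 3 (large-part-gap x b) ⟩
  3 * (8 * opt (5 + x + b)) ≡⟨ *-left-comm 3 8 (opt (5 + x + b)) ⟩
  8 * (3 * opt (5 + x + b)) ∎
  where
  open ≤-Reasoning
  8+x≤3*[5+x] : 8 + x ≤ 3 * (5 + x)
  8+x≤3*[5+x] = ≤-trans (+-mono-≤ (≤-by-computation {8} {15}) (m≤n*m x 3))
                        (≤-reflexive (sym (*-distribˡ-+ 3 5 x)))

insert-canonical : ∀ a → 0 < a → Canonical b c →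
                   Canonical↭ (a + b) (a ∷ c) ⊎ 9 * a * opt b ≤ 8 * opt (a + b)
insert-canonical {b} (suc (suc (suc (suc (suc x))))) _ _ = inj₂ (large-part-gap x b)
insert-canonical a a>0 (3∷ {r} r≥2 cc) with insert-canonical a a>0 cc
... | inj₁ (d , dd , a∷c↭d) =
  inj₁ (3 ∷ d
       , subst (λ s → Canonical s (3 ∷ d)) (sym (+-left-comm a 3 r)) (3∷ (≤-trans r≥2 (m≤n+m r a)) dd)
       , ↭-trans (swap a 3 ↭-refl) (prep 3 a∷c↭d))
... | inj₂ gap = inj₂ (begin
  9 * a * opt (3 + r)   ≡⟨ cong (9 * a *_) (opt-3+ r≥2) ⟩
  9 * a * (3 * opt r)   ≤⟨ *-scale-≤ 3 (9 * a) 8 (opt r) (opt (a + r)) gap ⟩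
  8 * (3 * opt (a + r)) ≡⟨ cong (8 *_) (opt-3+ (≤-trans r≥2 (m≤n+m r a))) ⟨
  8 * opt (3 + (a + r)) ≡⟨ cong (λ s → 8 * opt s) (+-left-comm a 3 r) ⟨
  8 * opt (a + (3 + r)) ∎)
  where open ≤-Reasoning
insert-canonical 1 _ [] = inj₁ (_ , [1] , ↭-refl)
insert-canonical 2 _ [] = inj₁ (_ , [2] , ↭-refl)
insert-canonical 3 _ [] = inj₁ (_ , [3] , ↭-refl)
insert-canonical 4 _ [] = inj₁ (_ , [4] , ↭-refl)
insert-canonical 1 _ [1] = inj₂ ≤-by-computation
insert-canonical 2 _ [1] = inj₂ ≤-by-computation
insert-canonical 3 _ [1] = inj₂ ≤-by-computation
insert-canonical 4 _ [1] = inj₂ ≤-by-computation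
insert-canonical 1 _ [2] = inj₂ ≤-by-computation
insert-canonical 2 _ [2] = inj₁ (_ , [2,2] , ↭-refl)
insert-canonical 3 _ [2] = inj₁ (_ , 3∷ ≤-by-computation [2] , ↭-refl)
insert-canonical 4 _ [2] = inj₂ ≤-by-computation
insert-canonical 1 _ [3] = inj₂ ≤-by-computation
insert-canonical 2 _ [3] = inj₁ (_ , 3∷ ≤-by-computation [2] , swap 2 3 ↭-refl)
insert-canonical 3 _ [3] = inj₁ (_ , 3∷ ≤-by-computation [3] , ↭-refl)
insert-canonical 4 _ [3] = inj₁ (_ , 3∷ ≤-by-computation [4] , swap 4 3 ↭-refl)
insert-canonical 1 _ [4] = inj₂ ≤-by-computation
insert-canonical 2 _ [4] = inj₂ ≤-by-computation
insert-canonical 3 _ [4] = inj₁ (_ , 3∷ ≤-by-computation [4] , ↭-refl)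
insert-canonical 4 _ [4] = inj₂ ≤-by-computation
insert-canonical 1 _ [2,2] = inj₂ ≤-by-computation
insert-canonical 2 _ [2,2] = inj₂ ≤-by-computation
insert-canonical 3 _ [2,2] = inj₁ (_ , 3∷ ≤-by-computation [2,2] , ↭-refl)
insert-canonical 4 _ [2,2] = inj₂ ≤-by-computation

m*opt[n]≤opt[m+n] : ∀ a → 0 < a → ∀ b → a * opt b ≤ opt (a + b)
m*opt[n]≤opt[m+n] a a>0 b with canonical b
... | c , cc with insert-canonical a a>0 cc
...   | inj₁ a∷c↭ = ≤-reflexive (begin
  a * opt b           ≡⟨ cong (a *_) (canonical-product cc) ⟨
  product (a ∷ c)     ≡⟨ canonical↭-product a∷c↭ ⟩
  opt (a + b)         ∎)
  where open ≡-Reasoning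
...   | inj₂ gap = 9*m≤8*n⇒m≤n (a * opt b) (opt (a + b))
                   (≤-trans (≤-reflexive (sym (*-assoc 9 a (opt b)))) gap)

canonical-or-gap : ∀ m → All (0 <_) m → Canonical↭ (sum m) m ⊎ 9 * product m ≤ 8 * opt (sum m)
canonical-or-gap [] [] = inj₁ ([] , [] , ↭-refl)
canonical-or-gap (a ∷ m) (a>0 ∷ m>0) with canonical-or-gap m m>0
... | inj₁ (c , cc , m↭c) with insert-canonical a a>0 cc
...   | inj₁ (d , dd , a∷c↭d) = inj₁ (d , dd , ↭-trans (prep a m↭c) a∷c↭d)
...   | inj₂ gap = inj₂ (begin
  9 * (a * product m)     ≡⟨ *-assoc 9 a (product m) ⟨
  9 * a * product m       ≡⟨ cong (9 * a *_) (canonical↭-product (c , cc , m↭c)) ⟩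
  9 * a * opt (sum m)     ≤⟨ gap ⟩
  8 * opt (a + sum m)     ∎)
  where open ≤-Reasoning
canonical-or-gap (a ∷ m) (a>0 ∷ m>0) | inj₂ gap = inj₂ (begin
  9 * (a * product m)     ≡⟨ *-left-comm 9 a (product m) ⟩
  a * (9 * product m)     ≤⟨ *-monoʳ-≤ a gap ⟩
  a * (8 * opt (sum m))   ≡⟨ *-left-comm a 8 (opt (sum m)) ⟩
  8 * (a * opt (sum m))   ≤⟨ *-monoʳ-≤ 8 (m*opt[n]≤opt[m+n] a a>0 (sum m)) ⟩
  8 * opt (a + sum m)     ∎)
  where open ≤-Reasoning

feasible-canonical-or-gap : Feasible r m → Canonical↭ r m ⊎ 9 * OBJ m ≤ 8 * opt r
feasible-canonical-or-gap {m = m} (m>0 , _ , refl) = canonical-or-gap m m>0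

optimal-or-gap : Feasible r m → OBJ m ≡ opt r ⊎ 9 * OBJ m ≤ 8 * opt r
optimal-or-gap = Sum.map₁ canonical↭-product ∘′ feasible-canonical-or-gap

opt-isOPT : ∀ r → IsOPT r (opt r)
opt-isOPT r with canonical r
... | c , cc = (c , canonical-feasible cc , canonical-product cc)
             , λ m feasible → [ ≤-reflexive , 9*m≤8*n⇒m≤n (OBJ m) (opt r) ]′ (optimal-or-gap feasible)

optimal-shape : 2 ≤ r → Feasible r m → OBJ m ≡ opt r → Shape r m
optimal-shape {r} {m} r≥2 feasible OBJ≡opt with feasible-canonical-or-gap feasible
... | inj₁ (c , cc , m↭c) = ShapeOf-↭ m↭c (canonical-shape r≥2 cc)
... | inj₂ gap = ⊥-elim (n≮n (8 * opt r) (begin-strict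
  8 * opt r     <⟨ +-monoˡ-≤ (8 * opt r) (opt-positive r) ⟩
  9 * opt r     ≡⟨ cong (9 *_) OBJ≡opt ⟨
  9 * OBJ m     ≤⟨ gap ⟩
  8 * opt r     ∎))
  where open ≤-Reasoning

lemma3p1 : (r : ℕ) → ∃ λ opt → IsOPT r opt
    × (∀ m → Feasible r m → OBJ m ≡ opt ⊎ 9 * OBJ m ≤ 8 * opt)
    × (2 ≤ r → ∀ m → Feasible r m → OBJ m ≡ opt →
        (r % 3 ≡ 0 → m ↭ replicate (r / 3) 3)
      × (r % 3 ≡ 1 → m ↭ 4 ∷ replicate (r / 3 ∸ 1) 3 ⊎ m ↭ 2 ∷ 2 ∷ replicate (r / 3 ∸ 1) 3)
      × (r % 3 ≡ 2 → m ↭ 2 ∷ replicate (r / 3) 3))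
lemma3p1 r = opt r , opt-isOPT r , (λ _ → optimal-or-gap) , (λ r≥2 _ → optimal-shape r≥2)
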